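{- Let $\mathcal I$ be a closed confluent IOSA with semantics $\mathcal P(\mathcal I)$. For every state $(s,\vec v)\in\mathsf{Inv}$, if $s$ is not stable and $\mu\in\mathcal T_a(s,\vec v)$ for some label $a\in\mathcal L$, then $a\in\mathcal A^{\mathsf u}$.
   Context: An IOSA is a tuple $\mathcal I=(\mathcal S,\mathcal A,\mathcal C,\rightarrow,C_0,s_0)$ with denumerable states $\mathcal S$, denumerable actions $\mathcal A$ partitioned into inputs $\mathcal A^{\mathsf i}$ and outputs $\mathcal A^{\mathsf o}$, urgent subset $\mathcal A^{\mathsf u}$ containing the silent action $\tau\in\mathcal A^{\mathsf u}\cap\mathcal A^{\mathsf o}$, finite clock set $\mathcal C=\{x_1,\dots,x_N\}$ with each $x_i$ carrying a continuous probability measure $\mu_{x_i}$ on $\mathbb R$ with $\mu_{x_i}(\mathbb R_{>0})=1$, transitions $s\xrightarrow{C,a,C'}s'$ ($C,C'\subseteq\mathcal C$), $C_0\subseteq\mathcal C$, initial state $s_0$, satisfying: (a) $a\in\mathcal A^{\mathsf i}\cup\mathcal A^{\mathsf u}$ implies $C=\emptyset$; (b) $a\in\mathcal A^{\mathsf o}\setminus\mathcal A^{\mathsf u}$ implies $C$ singleton; (c) transitions from one state guarded by the same single clock coincide; (d) input enabledness; (e) input determinism; (f) existence of $\mathrm{active}:\mathcal S\to2^{\mathcal C}$ with $\mathrm{active}(s_0)\subseteq C_0$, $\mathrm{enabling}(s)\subseteq\mathrm{active}(s)$, equality for stable $s$, and $\mathrm{active}(s)\subseteq(\mathrm{active}(t)\setminus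 C)\cup C'$ whenever $t\xrightarrow{C,a,C'}s$, where $\mathrm{enabling}(s)$ is the set of clocks $y$ with $s\xrightarrow{\{y\},\cdot,\cdot}\cdot$; fix such a function. A state $s$ is stable if no $a\in\mathcal A^{\mathsf u}\cap\mathcal A^{\mathsf o}$ has $s\xrightarrow{\emptyset,a,\cdot}\cdot$. Closed: $\mathcal A^{\mathsf i}=\emptyset$. Confluent: for all urgent $a,b$, state $s$ and $s\xrightarrow{\emptyset,a,C_1}s_1$, $s\xrightarrow{\emptyset,b,C_2}s_2$ there is $s_3$ with $s_1\xrightarrow{\emptyset,b,C_2}s_3$, $s_2\xrightarrow{\emptyset,a,C_1}s_3$. Semantics $\mathcal P(\mathcal I)$: states $\mathbf S=(\mathcal S\cup\{\mathsf{init}\})\times\mathbb R^N$, labels $\mathcal L=\mathcal A\cup\mathbb R_{>0}\cup\{\mathsf{init}\}$; $\mathcal T_{\mathsf{init}}(\mathsf{init},\vec v)=\{\delta_{s_0}\times\prod_i\mu_{x_i}\}$; for $a\in\mathcal A$: $\mathcal T_a(s,\vec v)=\{\delta_{s'}\times\prod_i\bar\mu_{x_i}\mid s\xrightarrow{C,a,C'}s',\ \vec v(i)\le0\ \forall x_i\in C\}$, $\bar\mu_{x_i}=\mu_{x_i}$ if $x_i\in C'$, else $\delta_{\vec v(i)}$; for $d\in\mathbb R_{>0}$: $\mathcal T_d(s,\vec v)=\{\delta_s\times\prod_i\delta_{\vec v(i)-d}\}$ if $s$ enables no action of $\mathcal A^{\mathsf u}\cap\mathcal A^{\mathsf o}$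 and $0<d\le\min\{\vec v(i)\mid\exists a\in\mathcal A^{\mathsf o},C',s': s\xrightarrow{\{x_i\},a,C'}s'\}$, else $\emptyset$; other combinations give $\emptyset$. $\mathsf{Inv}=\{(s,\vec v)\mid s\text{ stable},\ \forall x_i,x_j\in\mathrm{active}(s): i\ne j\Rightarrow\vec v(i)\ne\vec v(j),\ \vec v(i)\ge0\}\cup\{(s,\vec v)\mid s\text{ not stable},\ \forall x_i,x_j\in\mathrm{active}(s): i\ne j\Rightarrow\vec v(i)\ne\vec v(j),\ \vec v(i)>0\}\cup(\{\mathsf{init}\}\times\mathbb R^N)$. -}

module Defs where

open import Level using (0ℓ)
open import Data.Nat using (ℕ)
open import Data.Bool using (Bool; true; false; if_then_else_)
open import Data.Fin using (Fin)
open import Data.Fin.Subset using (Subset; _∈_; _∉_; _⊆_; ⁅_⁆) renaming (⊥ to ∅)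
open import Data.Vec using (lookup)
open import Data.Product using (Σ; ∃; ∃-syntax; _×_; _,_)
open import Data.Sum using (_⊎_)
open import Data.Unit using (⊤)
open import Data.Empty using (⊥)
open import Function.Bundles using (_↣_)
open import Relation.Nullary using (¬_)
open import Relation.Binary.PropositionalEquality using (_≡_)
open import Relation.Binary.Bundles using (StrictTotalOrder)

-- Agda's stdlib has no ℝ;
-- we work over an arbitrary strict total order with a zero and a
-- subtraction (ℝ with <, 0, - is an instance).  Only the order facts
-- (x ≤ y  :=  x < y or x ≈ y) matter for the semantics below.

record RealLike : Set₁ where
  field
    sto : StrictTotalOrder 0ℓ 0ℓ 0ℓ
  open StrictTotalOrder sto public
  field
    0ℝ  : Carrier
    _-_ : Carrier → Carrier → Carrier
  _≤_ : Carrier → Carrier → Set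
  x ≤ y = x < y ⊎ x ≈ y

-- Actions are partitioned into inputs/outputs by the Boolean `isInput`
-- (isInput a ≡ false means a is an output); `isUrgent` gives A^u.

record IOSA (N : ℕ) : Set₁ where
  field
    State    : Set
    Action   : Set
    stateDen  : State ↣ ℕ
    actionDen : Action ↣ ℕ
    isInput  : Action → Bool
    isUrgent : Action → Bool
    τ        : Action
    τ-urgent : isUrgent τ ≡ true
    τ-output : isInput τ ≡ false
    Trans    : State → Subset N → Action → Subset N → State → Set
    C₀       : Subset N
    s₀       : State

  Stable : State → Set
  Stable s = ¬ (Σ Action λ a → isUrgent a ≡ true × isInput a ≡ false ×
                 ∃[ C' ] ∃[ s' ] Trans s ∅ a C' s')

  Enabling : State → Fin N → Set
  Enabling s y = ∃[ a ] ∃[ C' ] ∃[ s' ] Trans s ⁅ y ⁆ a C' s'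

  field
    cond-a : ∀ {s C a C' s'} → Trans s C a C' s' →
             (isInput a ≡ true ⊎ isUrgent a ≡ true) → C ≡ ∅
    cond-b : ∀ {s C a C' s'} → Trans s C a C' s' →
             isInput a ≡ false → isUrgent a ≡ false → ∃[ x ] C ≡ ⁅ x ⁆
    cond-c : ∀ {s x a b C₁ C₂ s₁ s₂} →
             Trans s ⁅ x ⁆ a C₁ s₁ → Trans s ⁅ x ⁆ b C₂ s₂ →
             a ≡ b × C₁ ≡ C₂ × s₁ ≡ s₂
    cond-d : ∀ s a → isInput a ≡ true → ∃[ C ] ∃[ C' ] ∃[ s' ] Trans s C a C' s'
    cond-e : ∀ {s a C₁ C₂ C₁' C₂' s₁ s₂} → isInput a ≡ true →
             Trans s C₁ a C₁' s₁ → Trans s C₂ a C₂' s₂ →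
             C₁ ≡ C₂ × C₁' ≡ C₂' × s₁ ≡ s₂
    active        : State → Subset N
    active-init   : active s₀ ⊆ C₀
    enabling⊆act  : ∀ s y → Enabling s y → y ∈ active s
    stable-act⊆en : ∀ s y → Stable s → y ∈ active s → Enabling s y
    active-trans  : ∀ {t C a C' s} → Trans t C a C' s → ∀ y → y ∈ active s →
                    (y ∈ active t × y ∉ C) ⊎ y ∈ C'

Closed : ∀ {N} → IOSA N → Set
Closed I = ∀ a → isInput a ≡ false
  where open IOSA I

Confluent : ∀ {N} → IOSA N → Set
Confluent I = ∀ {s a b C₁ C₂ s₁ s₂} → isUrgent a ≡ true → isUrgent b ≡ true →
  Trans s ∅ a C₁ s₁ → Trans s ∅ b C₂ s₂ →
  ∃[ s₃ ] (Trans s₁ ∅ b C₂ s₃ × Trans s₂ ∅ a C₁ s₃)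
  where open IOSA I

module Semantics (R : RealLike) {N : ℕ} (I : IOSA N) where
  open RealLike R
  open IOSA I

  Valuation : Set
  Valuation = Fin N → Carrier

  data Loc : Set where
    init : Loc
    st   : State → Loc

  SState : Set
  SState = Loc × Valuation

  data Label : Set where
    act   : Action → Label
    delay : (d : Carrier) → 0ℝ < d → Label
    initL : Label

  -- i-th factor of a product measure: μ_{x_i} (symbolic) or a Dirac δ_r
  data Comp : Set where
    sample : Fin N → Comp
    dirac  : Carrier → Comp

  -- measure δ_{target} × ∏_i comps i
  record Meas : Set where
    constructor meas
    field
      target : Loc
      comps  : Fin N → Comp

  open Meas

  T : Label → SState → Meas → Set
  T initL (init , v) μ = target μ ≡ st s₀ × (∀ i → comps μ i ≡ sample i)
  T (act a) (st s , v) μ =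
    ∃[ C ] ∃[ C' ] ∃[ s' ] (Trans s C a C' s' × (∀ i → i ∈ C → v i ≤ 0ℝ) ×
      target μ ≡ st s' ×
      (∀ i → comps μ i ≡ (if lookup C' i then sample i else dirac (v i))))
  T (delay d _) (st s , v) μ =
    ¬ (Σ Action λ a → isUrgent a ≡ true × isInput a ≡ false ×
        ∃[ C ] ∃[ C' ] ∃[ s' ] Trans s C a C' s') ×
    (∀ i a C' s' → isInput a ≡ false → Trans s ⁅ i ⁆ a C' s' → d ≤ v i) ×
    target μ ≡ st s × (∀ i → comps μ i ≡ dirac (v i - d))
  T _ _ _ = ⊥

  Inv : SState → Set
  Inv (init , v) = ⊤
  Inv (st s , v) =
    (Stable s × (∀ i j → i ∈ active s → j ∈ active s → ¬ (i ≡ j) → ¬ (v i ≈ v j))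
              × (∀ i → i ∈ active s → 0ℝ ≤ v i))
    ⊎ (¬ Stable s × (∀ i j → i ∈ active s → j ∈ active s → ¬ (i ≡ j) → ¬ (v i ≈ v j))
              × (∀ i → i ∈ active s → 0ℝ < v i))

module Submission where

-- A non-stable state cannot let time pass, so only action transitions are
-- possible.  A non-urgent output of a closed IOSA is guarded by a single clock,
-- which is enabling and hence active; in the invariant every active clock of a
-- non-stable state is strictly positive, so the guard "clock ≤ 0" fails.

open import Defs
open import Data.Nat using (ℕ)
open import Data.Bool using (true; false)
open import Data.Product using (∃-syntax; _×_; _,_)
open import Data.Sum using (inj₁; inj₂)
open import Data.Empty using (⊥-elim)
open import Data.Fin.Subset using (_∈_)
open import Data.Fin.Subset.Properties using (x∈⁅x⁆)
open import Relation.Nullary using (¬_)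
open import Relation.Binary.PropositionalEquality using (_≡_; refl)

module _ (R : RealLike) where
  open RealLike R

  <⇒≱ : ∀ {x y} → x < y → ¬ (y ≤ x)
  <⇒≱ x<y (inj₁ y<x) = asym x<y y<x
  <⇒≱ x<y (inj₂ y≈x) = irrefl (Eq.sym y≈x) x<y

module _ (R : RealLike) {N : ℕ} (I : IOSA N) where
  open RealLike R using (_<_; 0ℝ)
  open IOSA I
  open Semantics R I

  Inv∧unstable⇒active-positive : ∀ {s v} → Inv (st s , v) → ¬ Stable s →
                                 ∀ i → i ∈ active s → 0ℝ < v i
  Inv∧unstable⇒active-positive (inj₁ (stable , _)) unstable = ⊥-elim (unstable stable)
  Inv∧unstable⇒active-positive (inj₂ (_ , _ , positive)) _  = positive

  unstable⇒no-delay : ∀ {s v d} {0<d : 0ℝ < d} {μ} → ¬ Stable s →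
                      ¬ T (delay d 0<d) (st s , v) μ
  unstable⇒no-delay unstable (no-urgent-output , _) =
    unstable λ (a , urgent , output , C' , s' , tr) →
      no-urgent-output (a , urgent , output , _ , C' , s' , tr)

  active-positive⇒timed-output-disabled :
    ∀ {s v a μ} → (∀ i → i ∈ active s → 0ℝ < v i) →
    isInput a ≡ false → isUrgent a ≡ false → ¬ T (act a) (st s , v) μ
  active-positive⇒timed-output-disabled positive output nonurgent
                                        (C , C' , s' , tr , expired , _)
    with cond-b tr output nonurgent
  ... | x , refl =
    <⇒≱ R (positive x (enabling⊆act _ x (_ , C' , s' , tr))) (expired x (x∈⁅x⁆ x))

lemma4 : (R : RealLike) (N : ℕ) (I : IOSA N) → Closed I → Confluent I →
    let open IOSA I
        open Semantics R I
    in ∀ s v → Inv (st s , v) → ¬ Stable s →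
       ∀ (ℓ : Label) (μ : Meas) → T ℓ (st s , v) μ →
       ∃[ a ] (ℓ ≡ act a × isUrgent a ≡ true)
lemma4 R N I closed _ s v inv unstable (Semantics.act a) μ t
  with IOSA.isUrgent I a in urgency
... | true  = a , refl , urgency
... | false = ⊥-elim (active-positive⇒timed-output-disabled R I
                        (Inv∧unstable⇒active-positive R I inv unstable)
                        (closed a) urgency t)
lemma4 R N I _ _ s v _ unstable (Semantics.delay d 0<d) μ t =
  ⊥-elim (unstable⇒no-delay R I {0<d = 0<d} unstable t)
lemma4 R N I _ _ s v _ _ Semantics.initL μ ()
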